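{- Let $G'$ be a multigraph, let $v,w$ be vertices with $\delta(v,w)\ge 2$, and consider the edge construction order and the notions of indispensable edges and $v$-/$w$-interesting vertices defined in the context. For any finite integer $k\ge1$, $I_k(v)\cup I_k(w)\subseteq D(v,w)$.
   Context: $\delta$ is the shortest-path distance in $G'$ ($\infty$ between different components). For a vertex $x$, let $\ell(x)=\min(\delta(x,v),\delta(x,w))$ and $U_k=\{x:\ell(x)=k\}$. Let $H$ be the union of the components of $v$ and $w$. The edges of $H$ are constructed in the following order: in phase $0$, all edges incident to $v$ or $w$; then in phase $k=1,2,\dots$, all not-yet-constructed edges incident to vertices of $U_k$ (in an arbitrary order within a phase). A vertex is explored once it is in $\{v,w\}$ or is an endpoint of an already constructed edge. An edge $(a,b)$ is indispensable if at the time of its construction one of its endpoints is explored for the first time by it (i.e., that endpoint is not in $\{v,w\}$ and is not an endpoint of any previously constructed edge); otherwise it is dispensable. A vertex $x$ is $v$-interesting if for every vertex $z\neq v$ with $\delta(v,z)+\delta(z,x)=\delta(v,x)$, all edges incident to $z$ are indispensable; $w$-interesting is defined symmetrically. $I_k(v)$ is the set of $v$-interesting vertices $x$ with $\delta(v,x)=k$, and $I_k(w)$ the set of $w$-interesting $x$ with $\delta(w,x)=k$. A vertex $u$ distinguishes $v,w$ if $|\delta(u,v)-\delta(u,w)|>1$ (true if exactly one distance is infinite); $D(v,w)$ is the set of such $u$. -}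

module Defs where

open import Data.Nat using (ℕ; zero; suc; _+_; _≤_; _<_)
open import Data.Fin using (Fin) renaming (_<_ to _<ᶠ_)
open import Data.Product using (Σ; ∃; ∃-syntax; _×_; _,_)
open import Data.Sum using (_⊎_)
open import Relation.Nullary using (¬_)
open import Relation.Binary.PropositionalEquality using (_≡_; _≢_)

-- A finite multigraph: vertices Fin n, edges Fin m (parallel edges and
-- loops allowed); edge e joins end₁ e and end₂ e.
record Multigraph (n m : ℕ) : Set where
  field
    end₁ end₂ : Fin m → Fin n

module _ {n m : ℕ} (G : Multigraph n m) where
  open Multigraph G

  Joins : Fin m → Fin n → Fin n → Set
  Joins e x y = (end₁ e ≡ x × end₂ e ≡ y) ⊎ (end₂ e ≡ x × end₁ e ≡ y)

  Incident : Fin m → Fin n → Set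
  Incident e x = end₁ e ≡ x ⊎ end₂ e ≡ x

  data Walk : Fin n → Fin n → ℕ → Set where
    nil  : ∀ {x} → Walk x x 0
    cons : ∀ {x y z k} (e : Fin m) → Joins e x y → Walk y z k → Walk x z (suc k)

  Connected : Fin n → Fin n → Set
  Connected x y = ∃[ k ] Walk x y k

  -- δ(x,y) = k  (finite shortest-path distance); δ(x,y) = ∞ iff ¬ Connected x y
  Dist : Fin n → Fin n → ℕ → Set
  Dist x y k = Walk x y k × (∀ j → Walk x y j → k ≤ j)

  -- u distinguishes v,w : |δ(u,v) − δ(u,w)| > 1, or exactly one is infinite
  Distinguishes : Fin n → Fin n → Fin n → Set
  Distinguishes u v w =
    (∃[ a ] ∃[ b ] (Dist u v a × Dist u w b × (suc (suc b) ≤ a ⊎ suc (suc a) ≤ b)))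
    ⊎ (Connected u v × ¬ Connected u w)
    ⊎ (¬ Connected u v × Connected u w)

  module _ (v w : Fin n) where

    -- ℓ(x) = k  :  min(δ(x,v), δ(x,w)) = k   (x ∈ U_k)
    Level : Fin n → ℕ → Set
    Level x k = (Dist x v k ⊎ Dist x w k) × (∀ j → Walk x v j ⊎ Walk x w j → k ≤ j)

    InH : Fin n → Set
    InH x = Connected v x ⊎ Connected w x

    InHEdge : Fin m → Set
    InHEdge e = InH (end₁ e)

    -- the phase in which edge e is constructed: the least level of its endpoints
    -- (phase 0 = edges incident to v or w; phase k = edges incident to U_k not
    -- constructed earlier)
    Phase : Fin m → ℕ → Set
    Phase e k = (Level (end₁ e) k ⊎ Level (end₂ e) k)
              × (∀ j → Level (end₁ e) j ⊎ Level (end₂ e) j → k ≤ j)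

    -- A construction order: an enumeration ord : Fin K → edges of H (each edge of
    -- H exactly once), ordered by phase, arbitrary inside a phase.
    record ConstructionOrder : Set where
      field
        K         : ℕ
        ord       : Fin K → Fin m
        injective : ∀ i j → ord i ≡ ord j → i ≡ j
        sound     : ∀ i → InHEdge (ord i)
        complete  : ∀ e → InHEdge e → ∃[ i ] ord i ≡ e
        monotone  : ∀ i j → i <ᶠ j → ∀ p q → Phase (ord i) p → Phase (ord j) q → p ≤ q

    module _ (O : ConstructionOrder) where
      open ConstructionOrder O

      ExploredBefore : Fin K → Fin n → Set
      ExploredBefore i x = x ≡ v ⊎ x ≡ w ⊎ (∃[ j ] (j <ᶠ i × Incident (ord j) x))

      Indispensable : Fin m → Set
      Indispensable e = ∃[ i ] (ord i ≡ e ×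
        (¬ ExploredBefore i (end₁ e) ⊎ ¬ ExploredBefore i (end₂ e)))

      -- x ∈ I_k(r) (r = v or r = w): δ(r,x) = k and x is r-interesting, i.e.
      -- every z ≠ r with δ(r,z)+δ(z,x) = δ(r,x) has all incident edges indispensable
      InI : Fin n → ℕ → Fin n → Set
      InI r k x = Dist r x k ×
        (∀ z → z ≢ r → ∀ a b → Dist r z a → Dist z x b → a + b ≡ k →
           ∀ e → Incident e z → Indispensable e)

-- Let r ∈ {v, w} be the root with x ∈ I_k(r) and s the other one, and walk along a
-- geodesic r = a₀, a₁, …, a_k = x.  All edges at a_{i+1} are indispensable, and a_i
-- was already explored by the edge a_{i-1}a_i, so the edge a_ia_{i+1} explores a_{i+1}
-- for the first time.  Since edges are built phase by phase, a first exploration raises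
-- the level by one, so ℓ(a_i) = i.  Inductively δ(a_i, s) ≥ i + 2: the first edge of a
-- short walk from a_{i+1} to s would either be the one exploring a_{i+1}, i.e. lead back
-- to a_i, or explore its other end, which then has level i + 2.  At i = k this gives
-- δ(x, s) ≥ δ(x, r) + 2.

{-# OPTIONS --safe #-}
module Submission where

open import Defs
open import Data.Nat using (ℕ; zero; suc; _+_; _∸_; _≤_; _<_; _≤?_; z≤n; s≤s)
open import Data.Nat.Properties
open import Data.Nat.Induction using (<-wellFounded)
open import Data.Fin using (Fin; toℕ)
import Data.Fin.Properties as Fin
open import Data.Product using (∃-syntax; _×_; _,_; proj₁; proj₂)
open import Data.Sum using (_⊎_; inj₁; inj₂)
open import Data.Empty using (⊥-elim)
open import Function using (_∘_)
open import Induction.WellFounded using (Acc; acc)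
open import Relation.Nullary using (¬_; Dec; yes; no)
open import Relation.Nullary.Decidable using (_×-dec_; _⊎-dec_; map′)
open import Relation.Unary using (Decidable)
open import Relation.Binary using (tri<; tri≈; tri>)
open import Relation.Binary.PropositionalEquality

least-witness : {P : ℕ → Set} → Decidable P → ∀ {J} → P J → ∃[ d ] (P d × (∀ j → P j → d ≤ j))
least-witness {P} P? {J} pJ = go (<-wellFounded J) pJ
  where
  go : ∀ {J} → Acc _<_ J → P J → ∃[ d ] (P d × (∀ j → P j → d ≤ j))
  go {J} (acc rs) pJ with anyUpTo? P? J
  ... | yes (i , i<J , pi) = go (rs i<J) pi
  ... | no none = J , pJ , λ j pj → ≮⇒≥ (λ j<J → none (j , j<J , pj))

module Walks {n m : ℕ} (G : Multigraph n m) where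
  open Multigraph G

  Joins-sym : ∀ {e x y} → Joins G e x y → Joins G e y x
  Joins-sym (inj₁ (p , q)) = inj₂ (q , p)
  Joins-sym (inj₂ (p , q)) = inj₁ (q , p)

  Joins⇒Incidentˡ : ∀ {e x y} → Joins G e x y → Incident G e x
  Joins⇒Incidentˡ (inj₁ (p , _)) = inj₁ p
  Joins⇒Incidentˡ (inj₂ (p , _)) = inj₂ p

  Joins⇒Incidentʳ : ∀ {e x y} → Joins G e x y → Incident G e y
  Joins⇒Incidentʳ j = Joins⇒Incidentˡ (Joins-sym j)

  Joins-other-end : ∀ {e p a b} → Joins G e p a → Joins G e a b → b ≡ p
  Joins-other-end (inj₁ (p₁ , a₂)) (inj₁ (a₁ , b₂)) = trans (sym b₂) (trans a₂ (trans (sym a₁) p₁))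
  Joins-other-end (inj₁ (p₁ , _))  (inj₂ (_ , b₁))  = trans (sym b₁) p₁
  Joins-other-end (inj₂ (p₂ , _))  (inj₁ (_ , b₂))  = trans (sym b₂) p₂
  Joins-other-end (inj₂ (p₂ , a₁)) (inj₂ (a₂ , b₁)) = trans (sym b₁) (trans a₁ (trans (sym a₂) p₂))

  module _ {P : Fin n → Set} where

    Joins-ends : ∀ {e a b} → Joins G e a b → P a → P b → P (end₁ e) × P (end₂ e)
    Joins-ends (inj₁ (refl , refl)) pa pb = pa , pb
    Joins-ends (inj₂ (refl , refl)) pa pb = pb , pa

    Joins-to-ends : ∀ {e a b} → Joins G e a b → P a ⊎ P b → P (end₁ e) ⊎ P (end₂ e)
    Joins-to-ends (inj₁ (refl , refl)) q = q
    Joins-to-ends (inj₂ (refl , refl)) (inj₁ pa) = inj₂ pa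
    Joins-to-ends (inj₂ (refl , refl)) (inj₂ pb) = inj₁ pb

    Joins-from-ends : ∀ {e a b} → Joins G e a b → P (end₁ e) ⊎ P (end₂ e) → P a ⊎ P b
    Joins-from-ends (inj₁ (refl , refl)) q = q
    Joins-from-ends (inj₂ (refl , refl)) (inj₁ pb) = inj₂ pb
    Joins-from-ends (inj₂ (refl , refl)) (inj₂ pa) = inj₁ pa

  _∷ʳ_ : ∀ {x y z k e} → Walk G x y k → Joins G e y z → Walk G x z (suc k)
  nil ∷ʳ j = cons _ j nil
  cons e j p ∷ʳ j′ = cons e j (p ∷ʳ j′)

  _++_ : ∀ {x y z a b} → Walk G x y a → Walk G y z b → Walk G x z (a + b)
  nil ++ q = q
  cons e j p ++ q = cons e j (p ++ q)

  reverse : ∀ {x y k} → Walk G x y k → Walk G y x k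
  reverse nil = nil
  reverse (cons e j p) = reverse p ∷ʳ Joins-sym j

  Walk-zero⇒≡ : ∀ {x y} → Walk G x y 0 → x ≡ y
  Walk-zero⇒≡ nil = refl

  joins? : ∀ e x y → Dec (Joins G e x y)
  joins? e x y = ((end₁ e Fin.≟ x) ×-dec (end₂ e Fin.≟ y)) ⊎-dec ((end₂ e Fin.≟ x) ×-dec (end₁ e Fin.≟ y))

  walk? : ∀ x y k → Dec (Walk G x y k)
  walk? x y zero with x Fin.≟ y
  ... | yes refl = yes nil
  ... | no x≢y = no (x≢y ∘ Walk-zero⇒≡)
  walk? x y (suc k) with Fin.any? (λ e → Fin.any? (λ z → joins? e x z ×-dec walk? z y k))
  ... | yes (e , z , j , p) = yes (cons e j p)
  ... | no none = no λ { (cons {y = z} e j p) → none (e , z , j , p) }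

  shortest : ∀ {x y J} → Walk G x y J → ∃[ d ] Dist G x y d
  shortest p = least-witness (walk? _ _) p

  splitAt : ∀ {x y k} → Walk G x y k → (i : ℕ) → i ≤ k → ∃[ z ] (Walk G x z i × Walk G z y (k ∸ i))
  splitAt {x} p zero _ = x , nil , p
  splitAt (cons e j p) (suc i) (s≤s i≤k) with splitAt p i i≤k
  ... | z , q , r = z , cons e j q , r

  shortcut : ∀ {x y J} → n ≤ J → Walk G x y J → ∃[ i ] (i < J × Walk G x y i)
  shortcut {x} {y} {J} n≤J p
    with Fin.pigeonhole (s≤s n≤J) (λ i → proj₁ (splitAt p (toℕ i) (Fin.toℕ≤pred[n] i)))
  ... | i , j , i<j , same
    with splitAt p (toℕ i) (Fin.toℕ≤pred[n] i) | splitAt p (toℕ j) (Fin.toℕ≤pred[n] j)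
  ... | _ , before , _ | _ , _ , after =
    toℕ i + (J ∸ toℕ j) , shorter , before ++ subst (λ u → Walk G u y (J ∸ toℕ j)) (sym same) after
    where
    shorter : toℕ i + (J ∸ toℕ j) < J
    shorter = subst (toℕ i + (J ∸ toℕ j) <_) (m+[n∸m]≡n (Fin.toℕ≤pred[n] j)) (+-monoˡ-< (J ∸ toℕ j) i<j)

  short-walk : ∀ {x y} → Connected G x y → ∃[ i ] (i < n × Walk G x y i)
  short-walk (_ , p) with shortest p
  ... | d , q , minimal with n ≤? d
  ... | no n≰d = d , ≰⇒> n≰d , q
  ... | yes n≤d = let i , i<d , r = shortcut n≤d q in ⊥-elim (<⇒≱ i<d (minimal i r))

  connected? : ∀ x y → Dec (Connected G x y)
  connected? x y = map′ (λ (i , _ , p) → i , p) short-walk (anyUpTo? (walk? x y) n)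

  Dist-sym : ∀ {x y k} → Dist G x y k → Dist G y x k
  Dist-sym (p , minimal) = reverse p , λ j q → minimal j (reverse q)

module Levels {n m : ℕ} (G : Multigraph n m) (v w : Fin n) where
  open Multigraph G
  open Walks G

  ToRoot : Fin n → ℕ → Set
  ToRoot u j = Walk G u v j ⊎ Walk G u w j

  to-root? : ∀ u j → Dec (ToRoot u j)
  to-root? u j = walk? u v j ⊎-dec walk? u w j

  ToRoot-cons : ∀ {e a b L} → Joins G e a b → ToRoot b L → ToRoot a (suc L)
  ToRoot-cons j (inj₁ p) = inj₁ (cons _ j p)
  ToRoot-cons j (inj₂ p) = inj₂ (cons _ j p)

  ToRoot-uncons : ∀ {b L} → ToRoot b (suc L) → ∃[ g ] ∃[ c ] (Joins G g b c × ToRoot c L)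
  ToRoot-uncons (inj₁ (cons g j p)) = g , _ , j , inj₁ p
  ToRoot-uncons (inj₂ (cons g j p)) = g , _ , j , inj₂ p

  Level⇒ToRoot : ∀ {u L} → Level G v w u L → ToRoot u L
  Level⇒ToRoot (inj₁ (p , _) , _) = inj₁ p
  Level⇒ToRoot (inj₂ (p , _) , _) = inj₂ p

  Level-minimal : ∀ {u L j} → Level G v w u L → ToRoot u j → L ≤ j
  Level-minimal (_ , minimal) = minimal _

  Level-functional : ∀ {u a b} → Level G v w u a → Level G v w u b → a ≡ b
  Level-functional A B = ≤-antisym (Level-minimal A (Level⇒ToRoot B)) (Level-minimal B (Level⇒ToRoot A))

  Level-zero : ∀ {u} → Level G v w u 0 → u ≡ v ⊎ u ≡ w
  Level-zero (inj₁ (p , _) , _) = inj₁ (Walk-zero⇒≡ p)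
  Level-zero (inj₂ (p , _) , _) = inj₂ (Walk-zero⇒≡ p)

  InH-step : ∀ {e b c} → InH G v w b → Joins G e b c → InH G v w c
  InH-step (inj₁ (_ , p)) j = inj₁ (_ , p ∷ʳ j)
  InH-step (inj₂ (_ , p)) j = inj₂ (_ , p ∷ʳ j)

  InH⇒ToRoot : ∀ {u} → InH G v w u → ∃[ j ] ToRoot u j
  InH⇒ToRoot (inj₁ (j , p)) = j , inj₁ (reverse p)
  InH⇒ToRoot (inj₂ (j , p)) = j , inj₂ (reverse p)

  level : ∀ {u} → InH G v w u → ∃[ L ] Level G v w u L
  level h with least-witness (to-root? _) (proj₂ (InH⇒ToRoot h))
  ... | L , inj₁ p , minimal = L , inj₁ (p , λ j q → minimal j (inj₁ q)) , minimal
  ... | L , inj₂ p , minimal = L , inj₂ (p , λ j q → minimal j (inj₂ q)) , minimal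

  Phase-functional : ∀ {e a b} → Phase G v w e a → Phase G v w e b → a ≡ b
  Phase-functional (A , min-a) (B , min-b) = ≤-antisym (min-a _ B) (min-b _ A)

  phase : ∀ {e a b La Lb} → Joins G e a b → Level G v w a La → Level G v w b Lb → ∃[ p ] Phase G v w e p
  phase {e} j A B with Joins-ends {P = λ u → ∃[ L ] Level G v w u L} j (_ , A) (_ , B)
  ... | (l₁ , L₁) , (l₂ , L₂) with ≤-total l₁ l₂
  ... | inj₁ l₁≤l₂ = l₁ , inj₁ L₁ , λ
        { j (inj₁ L) → ≤-reflexive (Level-functional L₁ L)
        ; j (inj₂ L) → ≤-trans l₁≤l₂ (≤-reflexive (Level-functional L₂ L)) }
  ... | inj₂ l₂≤l₁ = l₂ , inj₂ L₂ , λ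
        { j (inj₁ L) → ≤-trans l₂≤l₁ (≤-reflexive (Level-functional L₁ L))
        ; j (inj₂ L) → ≤-reflexive (Level-functional L₂ L) }

module Exploration {n m : ℕ} (G : Multigraph n m) (v w : Fin n) (O : ConstructionOrder G v w) where
  open Multigraph G
  open ConstructionOrder O
  open Walks G
  open Levels G v w

  Explored : Fin K → Fin n → Set
  Explored = ExploredBefore G v w O

  first-explorer-unique : ∀ {a t t′ e e′}
    → ord t ≡ e → Incident G e a → ¬ Explored t a
    → ord t′ ≡ e′ → Incident G e′ a → ¬ Explored t′ a
    → e ≡ e′
  first-explorer-unique {t = t} {t′} refl inc new refl inc′ new′ with Fin.<-cmp t t′
  ... | tri< t<t′ _ _ = ⊥-elim (new′ (inj₂ (inj₂ (t , t<t′ , inc))))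
  ... | tri≈ _ refl _ = refl
  ... | tri> _ _ t′<t = ⊥-elim (new (inj₂ (inj₂ (t′ , t′<t , inc′))))

  earlier-phase-explores : ∀ {g t b pg pe}
    → InHEdge G v w g → Incident G g b → Phase G v w g pg → Phase G v w (ord t) pe → pg < pe
    → Explored t b
  earlier-phase-explores {g} {t} h inc Pg Pe pg<pe with complete g h
  ... | tg , refl with Fin.<-cmp tg t
  ... | tri< tg<t _ _ = inj₂ (inj₂ (tg , tg<t , inc))
  ... | tri≈ _ refl _ = ⊥-elim (<⇒≢ pg<pe (Phase-functional Pg Pe))
  ... | tri> _ _ t<tg = ⊥-elim (<⇒≱ pg<pe (monotone t tg t<tg _ _ Pe Pg))

  Phase-≥-levelʳ : ∀ {e a b p La Lb}
    → Joins G e a b → Phase G v w e p → Level G v w a La → Level G v w b Lb → Lb ≤ La → Lb ≤ p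
  Phase-≥-levelʳ j (P , _) A B Lb≤La with Joins-from-ends {P = λ u → Level G v w u _} j P
  ... | inj₁ A′ = subst (_ ≤_) (Level-functional A A′) Lb≤La
  ... | inj₂ B′ = ≤-reflexive (Level-functional B B′)

  -- If b were no farther from the roots than a, an edge of strictly smaller phase
  -- would lead from b towards the roots, and it is constructed before e.
  explored-if-level-≤ : ∀ {e a b t La Lb}
    → Joins G e a b → ord t ≡ e → Level G v w a La → Level G v w b Lb → Lb ≤ La → InH G v w b
    → Explored t b
  explored-if-level-≤ {Lb = zero} j o A B _ _ with Level-zero B
  ... | inj₁ b≡v = inj₁ b≡v
  ... | inj₂ b≡w = inj₂ (inj₁ b≡w)
  explored-if-level-≤ {Lb = suc L} j refl A B Lb≤La hb
    with ToRoot-uncons (Level⇒ToRoot B)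
  ... | g , c , jg , c-to-root with InH-step hb jg
  ... | hc with level hc
  ... | Lc , C with phase jg B C | phase j A B
  ... | pg , Pg | pe , Pe =
    earlier-phase-explores (proj₁ (Joins-ends jg hb hc)) (Joins⇒Incidentˡ jg) Pg Pe pg<pe
    where
    pg<pe : pg < pe
    pg<pe = begin-strict
      pg     ≤⟨ proj₂ Pg Lc (Joins-to-ends jg (inj₂ C)) ⟩
      Lc     ≤⟨ Level-minimal C c-to-root ⟩
      L      <⟨ n<1+n L ⟩
      suc L  ≤⟨ Phase-≥-levelʳ j Pe A B Lb≤La ⟩
      pe     ∎
      where open ≤-Reasoning

  newly-explored-level : ∀ {e a b t La}
    → Joins G e a b → ord t ≡ e → ¬ Explored t b → Level G v w a La → InH G v w b
    → Level G v w b (suc La)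
  newly-explored-level {La = La} j o new A hb with level hb
  ... | Lb , B with suc La ≤? Lb
  ... | yes 1+La≤Lb = subst (Level G v w _) (≤-antisym Lb≤1+La 1+La≤Lb) B
    where
    Lb≤1+La : Lb ≤ suc La
    Lb≤1+La = Level-minimal B (ToRoot-cons (Joins-sym j) (Level⇒ToRoot A))
  ... | no 1+La≰Lb = ⊥-elim (new (explored-if-level-≤ j o A B (≤-pred (≰⇒> 1+La≰Lb)) hb))

module Geodesic {n m : ℕ} (G : Multigraph n m) (v w : Fin n) (O : ConstructionOrder G v w)
                (apart : ∀ k → Dist G v w k → 2 ≤ k) where
  open Multigraph G
  open ConstructionOrder O
  open Walks G
  open Levels G v w
  open Exploration G v w O

  data Roots : Fin n → Fin n → Set where
    v-w : Roots v w
    w-v : Roots w v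

  FarFrom : Fin n → Fin n → ℕ → Set
  FarFrom s a d = ∀ j → Walk G a s j → d ≤ j

  root-explored : ∀ {r s} → Roots r s → ∀ t → Explored t r
  root-explored v-w t = inj₁ refl
  root-explored w-v t = inj₂ (inj₁ refl)

  other-explored : ∀ {r s} → Roots r s → ∀ t → Explored t s
  other-explored v-w t = inj₂ (inj₁ refl)
  other-explored w-v t = inj₁ refl

  root-InH : ∀ {r s u} → Roots r s → Connected G r u → InH G v w u
  root-InH v-w c = inj₁ c
  root-InH w-v c = inj₂ c

  root-level : ∀ {r s} → Roots r s → Level G v w r 0
  root-level v-w = inj₁ (nil , λ _ _ → z≤n) , λ _ _ → z≤n
  root-level w-v = inj₂ (nil , λ _ _ → z≤n) , λ _ _ → z≤n

  Level-≤-other : ∀ {r s u L j} → Roots r s → Level G v w u L → Walk G u s j → L ≤ j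
  Level-≤-other v-w A p = Level-minimal A (inj₂ p)
  Level-≤-other w-v A p = Level-minimal A (inj₁ p)

  root-far : ∀ {r s} → Roots r s → FarFrom s r 2
  root-far v-w j p = let d , D = shortest p in ≤-trans (apart d D) (proj₂ D j p)
  root-far w-v j p = let d , D = shortest (reverse p) in ≤-trans (apart d D) (proj₂ D j (reverse p))

  distinguishes-if-far : ∀ {r s x k} → Roots r s → Dist G x r k → FarFrom s x (2 + k) → Distinguishes G x v w
  distinguishes-if-far {s = s} {x} R D far with R | connected? x s
  ... | v-w | no ¬c = inj₂ (inj₁ ((_ , proj₁ D) , ¬c))
  ... | w-v | no ¬c = inj₂ (inj₂ (¬c , (_ , proj₁ D)))
  ... | v-w | yes (_ , p) = let d , Dd = shortest p in inj₁ (_ , d , D , Dd , inj₂ (far d (proj₁ Dd)))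
  ... | w-v | yes (_ , p) = let d , Dd = shortest p in inj₁ (d , _ , Dd , D , inj₁ (far d (proj₁ Dd)))

  module Interesting {r s k x} (R : Roots r s) (I : InI G v w O r k x) where

    geodesic : Dist G r x k
    geodesic = proj₁ I

    geodesic-split : ∀ {b α β} → Walk G r b α → Walk G b x β → α + β ≡ k → Dist G r b α × Dist G b x β
    geodesic-split {β = β} p q refl =
      (p , λ j p′ → +-cancelʳ-≤ β _ j (proj₂ geodesic _ (p′ ++ q))) ,
      (q , λ j q′ → +-cancelˡ-≤ _ β j (proj₂ geodesic _ (p ++ q′)))

    data FirstExplored : Fin n → ℕ → Set where
      root : FirstExplored r 0
      by   : ∀ {p a i e} t → Walk G r p i → Joins G e p a → ord t ≡ e → ¬ Explored t a
           → FirstExplored a (suc i)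

    -- Were e the edge exploring a, b would precede a on the geodesic.
    explores-forward : ∀ {a b e i t}
      → FirstExplored a i → Joins G e a b → Dist G r b (suc i) → ord t ≡ e
      → ¬ Explored t a ⊎ ¬ Explored t b → ¬ Explored t b
    explores-forward _ _ _ _ (inj₂ new-b) = new-b
    explores-forward root _ _ _ (inj₁ new-r) = ⊥-elim (new-r (root-explored R _))
    explores-forward (by t′ pre jp o′ new′) j (_ , minimal) o (inj₁ new-a)
      with first-explorer-unique o′ (Joins⇒Incidentʳ jp) new′ o (Joins⇒Incidentˡ j) new-a
    ... | refl with Joins-other-end jp j
    ... | refl = ⊥-elim (1+n≰n (≤-trans (n≤1+n _) (minimal _ pre)))

    far-step : ∀ {a b e i t}
      → FarFrom s a (2 + i) → Joins G e a b → (∀ f → Incident G f b → Indispensable G v w O f)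
      → ord t ≡ e → ¬ Explored t b → Level G v w b (suc i) → InH G v w b
      → FarFrom s b (3 + i)
    far-step _ _ _ _ new-b _ _ zero q =
      ⊥-elim (new-b (subst (Explored _) (sym (Walk-zero⇒≡ q)) (other-explored R _)))
    far-step far-a j indispensable o new-b level-b hb (suc j′) (cons f jf rest)
      with indispensable f (Joins⇒Incidentˡ jf)
    ... | tf , of , new-end with Joins-from-ends {P = λ u → ¬ Explored tf u} jf new-end
    ... | inj₂ new-y = s≤s (Level-≤-other R (newly-explored-level jf of new-y level-b (InH-step hb jf)) rest)
    ... | inj₁ new-b′ with first-explorer-unique of (Joins⇒Incidentˡ jf) new-b′ o (Joins⇒Incidentʳ j) new-b
    ... | refl with Joins-other-end j jf
    ... | refl = s≤s (far-a j′ rest)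

    beyond-root-indispensable : ∀ {b α β} → Walk G r b (suc α) → Walk G b x β → suc α + β ≡ k
      → ∀ f → Incident G f b → Indispensable G v w O f
    beyond-root-indispensable {b} {α} {β} p q eq = proj₂ I b b≢r (suc α) β Db Dbx eq
      where
      Db : Dist G r b (suc α)
      Db = proj₁ (geodesic-split p q eq)
      Dbx : Dist G b x β
      Dbx = proj₂ (geodesic-split p q eq)
      b≢r : b ≢ r
      b≢r refl with proj₂ Db 0 nil
      ... | ()

    record Frontier (a : Fin n) (i : ℕ) : Set where
      constructor frontier
      field
        prefix         : Walk G r a i
        level-is       : Level G v w a i
        first-explored : FirstExplored a i
        far            : FarFrom s a (2 + i)

    start : Frontier r 0
    start = frontier nil (root-level R) root (root-far R)

    advance : ∀ {a b e i t} → Frontier a i → Joins G e a b → Walk G b x t → suc i + t ≡ k → Frontier b (suc i)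
    advance {b = b} {i = i} (frontier prefix level-a first-a far-a) j suffix eq
      with beyond-root-indispensable (prefix ∷ʳ j) suffix eq
    ... | indispensable with indispensable _ (Joins⇒Incidentʳ j)
    ... | te , oe , new-end =
      frontier (prefix ∷ʳ j) level-b (by te prefix j oe new-b)
               (far-step far-a j indispensable oe new-b level-b hb)
      where
      new-b : ¬ Explored te b
      new-b = explores-forward first-a j (proj₁ (geodesic-split (prefix ∷ʳ j) suffix eq)) oe
                (Joins-from-ends {P = λ u → ¬ Explored te u} j new-end)
      hb : InH G v w b
      hb = root-InH R (_ , prefix ∷ʳ j)
      level-b : Level G v w b (suc i)
      level-b = newly-explored-level j oe new-b level-a hb

    walk-on : ∀ {a i t} → Frontier a i → Walk G a x t → i + t ≡ k → Frontier x k
    walk-on {i = i} F nil eq = subst (Frontier x) (trans (sym (+-identityʳ i)) eq) F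
    walk-on {i = i} {suc t} F (cons _ j suffix) eq = walk-on (advance F j suffix eq′) suffix eq′
      where
      eq′ : suc i + t ≡ k
      eq′ = trans (sym (+-suc i _)) eq

    distinguishes : Distinguishes G x v w
    distinguishes = distinguishes-if-far R (Dist-sym geodesic) (Frontier.far (walk-on start (proj₁ geodesic) refl))

lemma15 : ∀ {n m} (G : Multigraph n m) (v w : Fin n)
            → (∀ k → Dist G v w k → 2 ≤ k)
            → (O : ConstructionOrder G v w)
            → ∀ (k : ℕ) → 1 ≤ k → ∀ (x : Fin n)
            → InI G v w O v k x ⊎ InI G v w O w k x
            → Distinguishes G x v w
lemma15 G v w apart O k _ x (inj₁ I) = Interesting.distinguishes v-w I
  where open Geodesic G v w O apart
lemma15 G v w apart O k _ x (inj₂ I) = Interesting.distinguishes w-v I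
  where open Geodesic G v w O apart
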